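{- (1) The families of bijections $(\psi_\chi)_{\chi \in 2^{\mathbb{Z}}}$ from $2\mathbb{Z}$ to $2\mathbb{Z}+1$ given by $\psi_\chi(n) = n+1$ for all $\chi$ (respectively $\psi_\chi(n) = n-1$ for all $\chi$) are not equivariant. (2) Assuming the law of excluded middle, there exists an equivariant family of bijections $(\psi_\chi \colon 2\mathbb{Z} \to 2\mathbb{Z}+1)_{\chi \in 2^{\mathbb{Z}}}$.
   Context: $2^{\mathbb{Z}}$ is the set of functions $\mathbb{Z} \to \{0,1\}$. $D_\infty = \langle t, r \mid r^2 = 1,\ r t r = t^{ -1}\rangle$ acts on $\mathbb{Z}$ by $t \cdot n = n+2$ and $r \cdot n = -n$ (restricting to $2\mathbb{Z}$ and $2\mathbb{Z}+1$), and on $2^{\mathbb{Z}}$ by $(t\cdot\chi)(n) = \chi(n-2)$, $(r \cdot \chi)(n) = 1 - \chi(-n)$. A family of bijections $(\psi_\chi)_{\chi \in 2^{\mathbb{Z}}}$ from $2\mathbb{Z}$ to $2\mathbb{Z}+1$ is equivariant if $\psi_{g \cdot \chi}(g \cdot n) = g \cdot \psi_\chi(n)$ for all $g \in D_\infty$, $\chi \in 2^{\mathbb{Z}}$, $n \in 2\mathbb{Z}$. -}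

module Defs where

open import Data.Bool using (Bool; true; false; not)
open import Data.Integer using (ℤ; +_; _+_; _-_; _*_; -_)
open import Data.Product using (Σ; ∃; _×_; _,_)
open import Relation.Binary.PropositionalEquality using (_≡_)

-- 2^ℤ : functions ℤ → {0,1}, with {0,1} represented by Bool (0 = false, 1 = true).
2^ℤ : Set
2^ℤ = ℤ → Bool

Even : ℤ → Set
Even n = Σ ℤ λ k → n ≡ + 2 * k

Odd : ℤ → Set
Odd n = Σ ℤ λ k → n ≡ + 2 * k + + 1

-- Elements of D∞ = ⟨ t , r | r² = 1 , r t r = t⁻¹ ⟩ in normal form t^k r^b
-- (every element is uniquely of this form); here b = true means r^1.
record D∞ : Set where
  constructor t^_r^_
  field
    k : ℤ
    b : Bool

-- Action of D∞ on ℤ:  t · n = n + 2 ,  r · n = - n.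
-- Hence (t^k r^b) · n = (r^b · n) + 2k.
r-act : Bool → ℤ → ℤ
r-act false n = n
r-act true  n = - n

_·ℤ_ : D∞ → ℤ → ℤ
(t^ k r^ b) ·ℤ n = r-act b n + + 2 * k

-- Action of D∞ on 2^ℤ:  (t · χ)(n) = χ(n - 2),  (r · χ)(n) = 1 - χ(-n).
-- Hence ((t^k r^b) · χ)(n) = (r^b · χ)(n - 2k).
r-actχ : Bool → 2^ℤ → 2^ℤ
r-actχ false χ = χ
r-actχ true  χ = λ n → not (χ (- n))

_·χ_ : D∞ → 2^ℤ → 2^ℤ
(t^ k r^ b) ·χ χ = λ n → r-actχ b χ (n - + 2 * k)

-- A family (ψ_χ)_χ of maps; each ψ_χ is only meaningful on 2ℤ.
Family : Set
Family = 2^ℤ → ℤ → ℤ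

IsBijection2ℤ→2ℤ+1 : (ℤ → ℤ) → Set
IsBijection2ℤ→2ℤ+1 f =
  (∀ n → Even n → Odd (f n)) ×
  (∀ m n → Even m → Even n → f m ≡ f n → m ≡ n) ×
  (∀ o → Odd o → ∃ λ n → Even n × f n ≡ o)

IsFamilyOfBijections : Family → Set
IsFamilyOfBijections ψ = ∀ χ → IsBijection2ℤ→2ℤ+1 (ψ χ)

Equivariant : Family → Set
Equivariant ψ = ∀ (g : D∞) (χ : 2^ℤ) (n : ℤ) → Even n →
  ψ (g ·χ χ) (g ·ℤ n) ≡ g ·ℤ ψ χ n

module Submission where

open import Defs
open import Level using (0ℓ)
open import Data.Integer using (ℤ; +_; _+_; _-_)
open import Data.Product using (Σ; _×_)
open import Relation.Nullary using (¬_)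
open import Axiom.ExcludedMiddle using (ExcludedMiddle)

open import Data.Bool using (Bool; true; false; not)
open import Data.Empty using (⊥; ⊥-elim)
open import Data.Integer using (-[1+_]; -≤+; +<+; 0ℤ; _*_; -_; suc; pred; ∣_∣; _≤_; _<_; _⊓_; _<?_)
import Data.Integer.Properties as ℤ
open import Data.Integer.Tactic.RingSolver using (solve-∀)
open import Data.Nat using (ℕ; zero)
import Data.Nat as ℕ
import Data.Nat.Properties as ℕ
open import Data.Product using (_,_; proj₁; proj₂)
open import Data.Sum using (_⊎_; inj₁; inj₂)
open import Relation.Nullary using (Dec; yes; no; does)
open import Relation.Nullary.Decidable using (dec-true; dec-false)
open import Relation.Binary using (tri<; tri≈; tri>)
open import Relation.Binary.PropositionalEquality

-- Proposition 3.3.  Part (1) is a computation with r and the constant word.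
-- Part (2): read χ ∈ 2^ℤ as a bi-infinite bracket word (1 = "(", 0 = ")")
-- with height function height χ.  The bracket at p is matched with the first
-- later position where the height returns to its level before p; partners
-- have opposite parity, so on a "full" word (all brackets matched) the
-- partner map is a bijection 2ℤ → 2ℤ+1.  Otherwise ψ_χ is n ↦ n ± 1, the
-- sign given by an orientation: an even minimum of the height, or no minimum
-- and an opening bracket that is never closed.

ℤ-induction : (P : ℤ → Set) → P 0ℤ → (∀ m → P m → P (suc m)) →
              (∀ m → P (suc m) → P m) → ∀ m → P m
ℤ-induction P p₀ up down (+ zero)        = p₀
ℤ-induction P p₀ up down (+ ℕ.suc n)     = up (+ n) (ℤ-induction P p₀ up down (+ n))
ℤ-induction P p₀ up down -[1+ zero ]     = down -[1+ zero ] p₀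
ℤ-induction P p₀ up down -[1+ ℕ.suc n ]  = down -[1+ ℕ.suc n ] (ℤ-induction P p₀ up down -[1+ n ])

same-increments : ∀ (f g s : ℤ → ℤ) → (∀ x → f (suc x) ≡ f x + s x) →
                  (∀ x → g (suc x) ≡ g x + s x) → ∀ x → f x ≡ g x + (f 0ℤ - g 0ℤ)
same-increments f g s f↑ g↑ x =
  trans (split (f x) (g x)) (cong (λ y → g x + y) (ℤ-induction (λ y → d y ≡ d 0ℤ) refl
    (λ y e → trans (d-suc y) e) (λ y e → trans (sym (d-suc y)) e) x))
  where
  d : ℤ → ℤ
  d y = f y - g y
  split : ∀ a b → a ≡ b + (a - b)
  split = solve-∀
  cancel : ∀ a b s → (a + s) - (b + s) ≡ a - b
  cancel = solve-∀
  d-suc : ∀ y → d (suc y) ≡ d y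
  d-suc y = trans (cong₂ _-_ (f↑ y) (g↑ y)) (cancel (f y) (g y) (s y))

+-cancelʳ : ∀ c {a b} → a + c ≡ b + c → a ≡ b
+-cancelʳ c {a} {b} a+c≡b+c = trans (add-sub a c) (trans (cong (_- c) a+c≡b+c) (sym (add-sub b c)))
  where add-sub : ∀ a c → a ≡ a + c - c
        add-sub = solve-∀

shift-≤ : ∀ c {a b a' b'} → a + c ≡ a' → b + c ≡ b' → a ≤ b → a' ≤ b'
shift-≤ c refl refl a≤b = ℤ.+-monoˡ-≤ c a≤b

shift-< : ∀ c {a b a' b'} → a + c ≡ a' → b + c ≡ b' → a < b → a' < b'
shift-< c refl refl a<b = ℤ.+-monoˡ-< c a<b

reflect-< : ∀ D {a b} → a < b → - b + D < - a + D
reflect-< D a<b = ℤ.+-monoˡ-< D (ℤ.neg-mono-< a<b)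

reflect-≤ : ∀ D {a b} → a ≤ b → - b + D ≤ - a + D
reflect-≤ D a≤b = ℤ.+-monoˡ-≤ D (ℤ.neg-mono-≤ a≤b)

pred< : ∀ x → pred x < x
pred< x = ℤ.suc[i]≤j⇒i<j (ℤ.≤-reflexive (ℤ.suc-pred x))

<suc : ∀ x → x < x + + 1
<suc x = ℤ.suc[i]≤j⇒i<j (ℤ.≤-reflexive (ℤ.+-comm (+ 1) x))

≤⇒+distance : ∀ {a x} → a ≤ x → x ≡ a + + ∣ x - a ∣
≤⇒+distance {a} {x} a≤x =
  trans (split x a) (cong (λ y → a + y) (sym (ℤ.0≤i⇒+∣i∣≡i (ℤ.i≤j⇒0≤j-i a≤x))))
  where split : ∀ x a → x ≡ a + (x - a)
        split = solve-∀

even-+ : ∀ {a b} → Even a → Even b → Even (a + b)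
even-+ (i , refl) (j , refl) = i + j , distrib i j
  where distrib : ∀ i j → + 2 * i + + 2 * j ≡ + 2 * (i + j)
        distrib = solve-∀

even-neg : ∀ {a} → Even a → Even (- a)
even-neg (i , refl) = - i , neg i
  where neg : ∀ i → - (+ 2 * i) ≡ + 2 * (- i)
        neg = solve-∀

even-cancel : ∀ {a b} → Even (a + b) → Even b → Even a
even-cancel {a} {b} ea+b eb = subst Even (add-sub a b) (even-+ ea+b (even-neg eb))
  where add-sub : ∀ a b → a + b + - b ≡ a
        add-sub = solve-∀

same-parity-even : ∀ {a b} → Even (a - b) → Even b → Even a
same-parity-even {a} {b} ea-b eb = subst Even (sub-add a b) (even-+ ea-b eb)
  where sub-add : ∀ a b → a - b + b ≡ a
        sub-add = solve-∀

even-pred : ∀ {n} → Even n → Odd (pred n)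
even-pred (k , refl) = k - + 1 , pred-even k
  where pred-even : ∀ k → -[1+ 0 ] + + 2 * k ≡ + 2 * (k - + 1) + + 1
        pred-even = solve-∀

odd-pred : ∀ {n} → Odd n → Even (pred n)
odd-pred (k , refl) = k , pred-odd k
  where pred-odd : ∀ k → -[1+ 0 ] + (+ 2 * k + + 1) ≡ + 2 * k
        pred-odd = solve-∀

odd-suc : ∀ {n} → Even n → Odd (n + + 1)
odd-suc (k , refl) = k , refl

even-or-odd : ∀ m → Even m ⊎ Odd m
even-or-odd = ℤ-induction _ (inj₁ (0ℤ , refl)) up down
  where
  suc-even : ∀ k → + 1 + + 2 * k ≡ + 2 * k + + 1
  suc-even = solve-∀
  suc-odd : ∀ k → + 1 + (+ 2 * k + + 1) ≡ + 2 * (k + + 1)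
  suc-odd = solve-∀
  up : ∀ m → Even m ⊎ Odd m → Even (suc m) ⊎ Odd (suc m)
  up m (inj₁ (k , refl)) = inj₂ (k , suc-even k)
  up m (inj₂ (k , refl)) = inj₁ (k + + 1 , suc-odd k)
  down : ∀ m → Even (suc m) ⊎ Odd (suc m) → Even m ⊎ Odd m
  down m (inj₁ e) = inj₂ (subst Odd (ℤ.pred-suc m) (even-pred e))
  down m (inj₂ o) = inj₁ (subst Even (ℤ.pred-suc m) (odd-pred o))

even-odd-disjoint : ∀ {m} → Even m → Odd m → ⊥
even-odd-disjoint (i , refl) (j , 2i≡2j+1) = two≢one (ℕ.m*n≡1⇒m≡1 2 ∣ i - j ∣ (begin
    2 ℕ.* ∣ i - j ∣   ≡⟨ sym (ℤ.abs-* (+ 2) (i - j)) ⟩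
    ∣ + 2 * (i - j) ∣ ≡⟨ cong ∣_∣ (trans (distrib i j) (cong (_- + 2 * j) 2i≡2j+1)) ⟩
    ∣ + 2 * j + + 1 - + 2 * j ∣ ≡⟨ cong ∣_∣ (cancel j) ⟩
    1 ∎))
  where open ≡-Reasoning
        distrib : ∀ i j → + 2 * (i - j) ≡ + 2 * i - + 2 * j
        distrib = solve-∀
        cancel : ∀ j → + 2 * j + + 1 - + 2 * j ≡ + 1
        cancel = solve-∀
        two≢one : 2 ≢ 1
        two≢one ()

-- Read a word χ ∈ 2^ℤ as a bi-infinite bracket sequence (true = "(",
-- false = ")").  Its height function is normalised by height χ 0 = 0 and
-- climbs by step (χ n) when passing from n - 1 to n.
step : Bool → ℤ
step true  = + 1
step false = -[1+ 0 ]

step-not : ∀ b → step (not b) ≡ - step b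
step-not true  = refl
step-not false = refl

height⁺ : 2^ℤ → ℕ → ℤ
height⁺ χ zero      = 0ℤ
height⁺ χ (ℕ.suc n) = height⁺ χ n + step (χ (+ ℕ.suc n))

height⁻ : 2^ℤ → ℕ → ℤ
height⁻ χ zero      = 0ℤ - step (χ (+ 0))
height⁻ χ (ℕ.suc n) = height⁻ χ n - step (χ -[1+ n ])

height : 2^ℤ → ℤ → ℤ
height χ (+ n)    = height⁺ χ n
height χ -[1+ n ] = height⁻ χ n

height-suc : ∀ χ x → height χ (suc x) ≡ height χ x + step (χ (suc x))
height-suc χ (+ n)             = refl
height-suc χ -[1+ zero ]       = sub-add 0ℤ (step (χ (+ 0)))
  where sub-add : ∀ a s → a ≡ (a - s) + s
        sub-add = solve-∀
height-suc χ -[1+ ℕ.suc n ]    = sub-add (height⁻ χ n) (step (χ -[1+ n ]))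
  where sub-add : ∀ a s → a ≡ (a - s) + s
        sub-add = solve-∀

height-pred : ∀ χ x → height χ x ≡ height χ (pred x) + step (χ x)
height-pred χ x = subst (λ y → height χ y ≡ height χ (pred x) + step (χ y))
                        (ℤ.suc-pred x) (height-suc χ (pred x))

opener-raises : ∀ χ n → χ n ≡ true → height χ (pred n) < height χ n
opener-raises χ n χn≡true = subst (height χ (pred n) <_)
  (sym (trans (height-pred χ n) (cong (λ b → height χ (pred n) + step b) χn≡true)))
  (<suc (height χ (pred n)))

-- height χ m ≡ m (mod 2): each step changes both sides by one.
height-parity : ∀ χ m → Even (height χ m + m)
height-parity χ = ℤ-induction _ (0ℤ , refl) up down
  where
  step+1-even : ∀ b → Even (step b + + 1)
  step+1-even true  = + 1 , refl
  step+1-even false = 0ℤ , refl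
  regroup : ∀ a m s → (a + s) + (+ 1 + m) ≡ (a + m) + (s + + 1)
  regroup = solve-∀
  after-step : ∀ m → height χ (suc m) + suc m ≡ (height χ m + m) + (step (χ (suc m)) + + 1)
  after-step m = trans (cong (_+ suc m) (height-suc χ m)) (regroup (height χ m) m (step (χ (suc m))))
  up : ∀ m → Even (height χ m + m) → Even (height χ (suc m) + suc m)
  up m e = subst Even (sym (after-step m)) (even-+ e (step+1-even (χ (suc m))))
  down : ∀ m → Even (height χ (suc m) + suc m) → Even (height χ m + m)
  down m e = even-cancel (subst Even (after-step m) e) (step+1-even (χ (suc m)))

equal-height⇒same-parity : ∀ χ {a b} → height χ a ≡ height χ b → Even (a - b)
equal-height⇒same-parity χ {a} {b} ha≡hb = subst Even (cancel (height χ a) a b)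
  (even-+ (height-parity χ a)
          (even-neg (subst (λ y → Even (y + b)) (sym ha≡hb) (height-parity χ b))))
  where cancel : ∀ h a b → (h + a) + - (h + b) ≡ a - b
        cancel = solve-∀

-- The bracket
-- opened at p is closed at q when q is the first position after p at which
-- the height returns to its level h (pred p) just before p.
Matched : (ℤ → ℤ) → ℤ → ℤ → Set
Matched h p q = p < q × h q ≡ h (pred p) × (∀ m → p ≤ m → m < q → h (pred p) < h m)

Partner : (ℤ → ℤ) → ℤ → ℤ → Set
Partner h n q = Matched h n q ⊎ Matched h q n

Full : (ℤ → ℤ) → Set
Full h = ∀ n → Σ ℤ (Partner h n)

module _ {h : ℤ → ℤ} where

  closing-unique : ∀ {p q q'} → Matched h p q → Matched h p q' → q ≡ q'
  closing-unique {p} {q} {q'} (p<q , hq , above) (p<q' , hq' , above') with ℤ.<-cmp q q'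
  ... | tri< q<q' _ _ = ⊥-elim (ℤ.<-irrefl (sym hq) (above' q (ℤ.<⇒≤ p<q) q<q'))
  ... | tri≈ _ q≡q' _ = q≡q'
  ... | tri> _ _ q'<q = ⊥-elim (ℤ.<-irrefl (sym hq') (above q' (ℤ.<⇒≤ p<q') q'<q))

  opening-unique : ∀ {p p' q} → Matched h p q → Matched h p' q → p ≡ p'
  opening-unique {p} {p'} (p<q , hq , above) (p'<q , hq' , above') with ℤ.<-cmp p p'
  ... | tri< p<p' _ _ = ⊥-elim (ℤ.<-irrefl (trans (sym hq) hq')
          (above (pred p') (ℤ.i<j⇒i≤pred[j] p<p') (ℤ.<-trans (pred< p') p'<q)))
  ... | tri≈ _ p≡p' _ = p≡p'
  ... | tri> _ _ p'<p = ⊥-elim (ℤ.<-irrefl (trans (sym hq') hq)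
          (above' (pred p) (ℤ.i<j⇒i≤pred[j] p'<p) (ℤ.<-trans (pred< p) p<q)))

  -- No position both closes one pair and opens another: heights inside the
  -- first pair stay above the level at which the second one starts.
  not-close-and-open : ∀ {p n q} → Matched h p n → Matched h n q → ⊥
  not-close-and-open {p} {n} (p<n , hn , above) (n<q , _ , above') =
    ℤ.<-asym (above' n ℤ.≤-refl n<q)
      (subst (_< h (pred n)) (sym hn) (above (pred n) (ℤ.i<j⇒i≤pred[j] p<n) (pred< n)))

  partner-functional : ∀ {n q q'} → Partner h n q → Partner h n q' → q ≡ q'
  partner-functional (inj₁ n→q) (inj₁ n→q') = closing-unique n→q n→q'
  partner-functional (inj₁ n→q) (inj₂ q'→n) = ⊥-elim (not-close-and-open q'→n n→q)
  partner-functional (inj₂ q→n) (inj₁ n→q') = ⊥-elim (not-close-and-open q→n n→q')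
  partner-functional (inj₂ q→n) (inj₂ q'→n) = opening-unique q→n q'→n

  partner-sym : ∀ {n q} → Partner h n q → Partner h q n
  partner-sym (inj₁ n→q) = inj₂ n→q
  partner-sym (inj₂ q→n) = inj₁ q→n

-- Partners in a bracket word have opposite parity (they enclose a balanced,
-- hence even-length, word).
partner-parity : ∀ χ {n q} → Partner (height χ) n q → Even (n + q + + 1)
partner-parity χ (inj₁ n→q)      = matched-parity n→q
  where
  regroup : ∀ p q → q - (-[1+ 0 ] + p) + + 2 * p ≡ p + q + + 1
  regroup = solve-∀
  matched-parity : ∀ {p q} → Matched (height χ) p q → Even (p + q + + 1)
  matched-parity {p} {q} (_ , hq , _) =
    subst Even (regroup p q) (even-+ (equal-height⇒same-parity χ {q} {pred p} hq) (p , refl))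
partner-parity χ {n} {q} (inj₂ q→n) =
  subst Even (swap q n) (partner-parity χ (inj₁ q→n))
  where swap : ∀ q n → q + n + + 1 ≡ n + q + + 1
        swap = solve-∀

partner-of-even : ∀ χ {n q} → Partner (height χ) n q → Even n → Odd q
partner-of-even χ {n} {q} nq even-n = subst Odd (pred-suc q)
  (even-pred {q + + 1} (even-cancel (subst Even (regroup n q) (partner-parity χ nq)) even-n))
  where regroup : ∀ n q → n + q + + 1 ≡ q + + 1 + n
        regroup = solve-∀
        pred-suc : ∀ q → -[1+ 0 ] + (q + + 1) ≡ q
        pred-suc = solve-∀

partner-of-odd : ∀ χ {n q} → Partner (height χ) n q → Odd n → Even q
partner-of-odd χ {q = q} nq (k , refl) =
  even-cancel (subst Even (regroup k q) (partner-parity χ nq)) (k + + 1 , twice-suc k)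
  where regroup : ∀ k q → + 2 * k + + 1 + q + + 1 ≡ q + (+ 2 * k + + 1 + + 1)
        regroup = solve-∀
        twice-suc : ∀ k → + 2 * k + + 1 + + 1 ≡ + 2 * (k + + 1)
        twice-suc = solve-∀

-- The quantities that decide the orientation of a word with unmatched
-- brackets: minima of the height, and brackets that are never closed
-- (the height never comes back down to h (pred o) after o) or never opened
-- (the height is above h c everywhere before c).
IsMin : (ℤ → ℤ) → ℤ → Set
IsMin h m = ∀ x → h m ≤ h x

HasMin : (ℤ → ℤ) → Set
HasMin h = Σ ℤ (IsMin h)

EvenMin : (ℤ → ℤ) → Set
EvenMin h = Σ ℤ λ m → Even m × IsMin h m

minima-same-parity : ∀ χ {m m'} → IsMin (height χ) m → IsMin (height χ) m' → Even (m - m')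
minima-same-parity χ {m} {m'} min min' =
  equal-height⇒same-parity χ {m} {m'} (ℤ.≤-antisym (min m') (min' m))

NeverClosed : (ℤ → ℤ) → Set
NeverClosed h = Σ ℤ λ o → ∀ x → o ≤ x → h (pred o) < h x

NeverOpened : (ℤ → ℤ) → Set
NeverOpened h = Σ ℤ λ c → ∀ x → x < c → h c < h x

-- Symmetries of height profiles.  h' is h translated by D, or reflected
-- (x ↦ - x + D on brackets, which is pred (- x + D) on the gaps between
-- brackets where heights live), up to an additive constant c.
Translated : (ℤ → ℤ) → (ℤ → ℤ) → ℤ → ℤ → Set
Translated h' h D c = ∀ x → h' x ≡ h (x - D) + c

Reflected : (ℤ → ℤ) → (ℤ → ℤ) → ℤ → ℤ → Set
Reflected h' h D c = ∀ x → h' x ≡ h (pred (- x + D)) + c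

module _ {h' h : ℤ → ℤ} {D c : ℤ} (h'≈h : Translated h' h D c) where

  translated-at : ∀ x → h' (x + D) ≡ h x + c
  translated-at x = trans (h'≈h (x + D)) (cong (λ y → h y + c) (add-sub x D))
    where add-sub : ∀ x D → x + D - D ≡ x
          add-sub = solve-∀

  translated-inverse : Translated h h' (- D) (- c)
  translated-inverse y = begin
    h y                  ≡⟨ add-sub (h y) c ⟩
    h y + c - c          ≡⟨ cong (_- c) (sym (translated-at y)) ⟩
    h' (y + D) - c       ≡⟨ cong (λ z → h' z - c) (sym (sub-neg y D)) ⟩
    h' (y - - D) + - c   ∎
    where open ≡-Reasoning
          add-sub : ∀ a c → a ≡ a + c - c
          add-sub = solve-∀
          sub-neg : ∀ y D → y - - D ≡ y + D
          sub-neg = solve-∀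

  translated-before : ∀ p → h' (pred (p + D)) ≡ h (pred p) + c
  translated-before p = trans (cong h' (sym (ℤ.+-assoc (-[1+ 0 ]) p D))) (translated-at (pred p))

  untranslate-≤ : ∀ {a m} → a + D ≤ m → a ≤ m - D
  untranslate-≤ {a} = shift-≤ (- D) (add-sub a D) refl
    where add-sub : ∀ a D → a + D + - D ≡ a
          add-sub = solve-∀

  untranslate-< : ∀ {m b} → m < b + D → m - D < b
  untranslate-< {b = b} = shift-< (- D) refl (add-sub b D)
    where add-sub : ∀ a D → a + D + - D ≡ a
          add-sub = solve-∀

  translate-matched : ∀ {p q} → Matched h p q → Matched h' (p + D) (q + D)
  translate-matched {p} {q} (p<q , hq , above) =
    ℤ.+-monoˡ-< D p<q ,
    trans (translated-at q) (trans (cong (_+ c) hq) (sym (translated-before p))) ,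
    λ m p+D≤m m<q+D → shift-< c (sym (translated-before p)) (sym (h'≈h m))
                        (above (m - D) (untranslate-≤ p+D≤m) (untranslate-< m<q+D))

  translate-partner : ∀ {n q} → Partner h n q → Partner h' (n + D) (q + D)
  translate-partner (inj₁ n→q) = inj₁ (translate-matched n→q)
  translate-partner (inj₂ q→n) = inj₂ (translate-matched q→n)

  translate-full : Full h → Full h'
  translate-full full n with full (n - D)
  ... | q , nq = q + D , subst (λ y → Partner h' y (q + D)) (sub-add n D) (translate-partner nq)
    where sub-add : ∀ n D → n - D + D ≡ n
          sub-add = solve-∀

  translate-min : ∀ {m} → IsMin h m → IsMin h' (m + D)
  translate-min {m} min x = shift-≤ c (sym (translated-at m)) (sym (h'≈h x)) (min (x - D))

  translate-never-closed : NeverClosed h → NeverClosed h'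
  translate-never-closed (o , above) = o + D , λ x o+D≤x →
    shift-< c (sym (translated-before o)) (sym (h'≈h x)) (above (x - D) (untranslate-≤ o+D≤x))

mirror-< : ∀ D {a b} → a < - b + D → b < - a + D
mirror-< D {a} {b} a<-b+D = subst (_< - a + D) (involutive b D) (reflect-< D a<-b+D)
  where involutive : ∀ b D → - (- b + D) + D ≡ b
        involutive = solve-∀

mirror-≥ : ∀ D {a b} → - a + D ≤ b → - b + D ≤ a
mirror-≥ D {a} {b} -a+D≤b = subst (- b + D ≤_) (involutive a D) (reflect-≤ D -a+D≤b)
  where involutive : ∀ a D → - (- a + D) + D ≡ a
        involutive = solve-∀

module _ {h' h : ℤ → ℤ} {D c : ℤ} (h'≈h : Reflected h' h D c) where

  reflected-at : ∀ x → h' (- x + D) ≡ h (pred x) + c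
  reflected-at x = trans (h'≈h (- x + D)) (cong (λ y → h (pred y) + c) (involutive x D))
    where involutive : ∀ x D → - (- x + D) + D ≡ x
          involutive = solve-∀

  reflected-before : ∀ x → h' (pred (- x + D)) ≡ h x + c
  reflected-before x = trans (h'≈h (pred (- x + D))) (cong (λ y → h y + c) (involutive x D))
    where involutive : ∀ x D → -[1+ 0 ] + (- (-[1+ 0 ] + (- x + D)) + D) ≡ x
          involutive = solve-∀

  reflected-inverse : Reflected h h' D (- c)
  reflected-inverse y = begin
    h y                              ≡⟨ add-sub (h y) c ⟩
    h y + c - c                      ≡⟨ cong (_- c) (sym (reflected-before y)) ⟩
    h' (pred (- y + D)) + - c        ∎
    where open ≡-Reasoning
          add-sub : ∀ a c → a ≡ a + c - c
          add-sub = solve-∀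

  reflect-matched : ∀ {p q} → Matched h p q → Matched h' (- q + D) (- p + D)
  reflect-matched {p} {q} (p<q , hq , above) =
    reflect-< D p<q ,
    trans (reflected-at p) (trans (cong (_+ c) (sym hq)) (sym (reflected-before q))) ,
    λ m -q+D≤m m<-p+D →
      shift-< c (trans (cong (_+ c) (sym hq)) (sym (reflected-before q))) (sym (h'≈h m))
        (above (pred (- m + D)) (ℤ.i<j⇒i≤pred[j] (mirror-< D m<-p+D))
               (ℤ.<-≤-trans (pred< (- m + D)) (mirror-≥ D -q+D≤m)))

  reflect-partner : ∀ {n q} → Partner h n q → Partner h' (- n + D) (- q + D)
  reflect-partner (inj₁ n→q) = inj₂ (reflect-matched n→q)
  reflect-partner (inj₂ q→n) = inj₁ (reflect-matched q→n)

  reflect-full : Full h → Full h'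
  reflect-full full n with full (- n + D)
  ... | q , nq = - q + D , subst (λ y → Partner h' y (- q + D)) (involutive n D) (reflect-partner nq)
    where involutive : ∀ n D → - (- n + D) + D ≡ n
          involutive = solve-∀

  reflect-min : ∀ {m} → IsMin h m → IsMin h' (pred (- m + D))
  reflect-min {m} min x = shift-≤ c (sym (reflected-before m)) (sym (h'≈h x)) (min (pred (- x + D)))

  reflect-never-closed : NeverClosed h → NeverOpened h'
  reflect-never-closed (o , above) = - o + D , λ y y<-o+D →
    shift-< c (sym (reflected-at o)) (sym (h'≈h y)) (above _ (ℤ.i<j⇒i≤pred[j] (mirror-< D y<-o+D)))

  reflect-never-opened : NeverOpened h → NeverClosed h'
  reflect-never-opened (c' , above) = - c' + D , λ y -c'+D≤y →
    shift-< c (sym (reflected-before c')) (sym (h'≈h y))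
      (above _ (ℤ.<-≤-trans (pred< (- y + D)) (mirror-≥ D -c'+D≤y)))

-- The group action on words moves heights by these symmetries: the height of
-- t^k · χ is a translate of the height of χ, that of t^k r · χ a reflection.
height-translate : ∀ χ D → Σ ℤ (Translated (height (λ n → χ (n - D))) (height χ) D)
height-translate χ D = _ , same-increments (height φ) (λ x → height χ (x - D)) s
                                           (height-suc φ) χ↑
  where
  φ : 2^ℤ
  φ n = χ (n - D)
  s : ℤ → ℤ
  s x = step (χ (suc x - D))
  commute : ∀ x D → + 1 + (x - D) ≡ + 1 + x - D
  commute = solve-∀
  χ↑ : ∀ x → height χ (suc x - D) ≡ height χ (x - D) + s x
  χ↑ x = subst (λ y → height χ y ≡ height χ (x - D) + step (χ y)) (commute x D)
               (height-suc χ (x - D))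

height-reflect : ∀ χ D → Σ ℤ (Reflected (height (λ n → not (χ (- (n - D))))) (height χ) D)
height-reflect χ D = _ , same-increments (height φ) (λ x → height χ (pred (- x + D))) s φ↑ χ↑
  where
  φ : 2^ℤ
  φ n = not (χ (- (n - D)))
  s : ℤ → ℤ
  s x = step (not (χ (pred (- x + D))))
  mirror-suc : ∀ x D → - (+ 1 + x - D) ≡ -[1+ 0 ] + (- x + D)
  mirror-suc = solve-∀
  φ↑ : ∀ x → height φ (suc x) ≡ height φ x + s x
  φ↑ x = trans (height-suc φ x) (cong (λ y → height φ x + step (not (χ y))) (mirror-suc x D))
  pred-pred : ∀ x D → -[1+ 0 ] + (- (+ 1 + x) + D) ≡ -[1+ 0 ] + (-[1+ 0 ] + (- x + D))
  pred-pred = solve-∀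
  solve-for-pred : ∀ a b s → a ≡ b + s → b ≡ a + - s
  solve-for-pred a b s refl = cancel b s
    where cancel : ∀ b s → b ≡ b + s + - s
          cancel = solve-∀
  descend : ∀ y → height χ (pred y) ≡ height χ y + step (not (χ y))
  descend y = trans (solve-for-pred _ _ _ (height-pred χ y))
                    (cong (λ z → height χ y + z) (sym (step-not (χ y))))
  χ↑ : ∀ x → height χ (pred (- suc x + D)) ≡ height χ (pred (- x + D)) + s x
  χ↑ x = trans (cong (height χ) (pred-pred x D)) (descend (pred (- x + D)))

SlowDescent : (ℤ → ℤ) → Set
SlowDescent h = ∀ x → h x - + 1 ≤ h (suc x)

height-slow : ∀ χ → SlowDescent (height χ)
height-slow χ x = subst (height χ x - + 1 ≤_) (sym (height-suc χ x))
                        (ℤ.+-monoʳ-≤ (height χ x) (step≥-1 (χ (suc x))))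
  where step≥-1 : ∀ b → -[1+ 0 ] ≤ step b
        step≥-1 true  = -≤+
        step≥-1 false = ℤ.≤-refl

module _ {h : ℤ → ℤ} (slow : SlowDescent h) where

  descent-bound : ∀ a j → h a - + j ≤ h (a + + j)
  descent-bound a zero = ℤ.≤-reflexive (trans (ℤ.+-identityʳ (h a)) (cong h (sym (ℤ.+-identityʳ a))))
  descent-bound a (ℕ.suc j) = begin
    h a - (+ 1 + + j)   ≡⟨ regroup (h a) (+ j) ⟩
    h a - + j - + 1     ≤⟨ ℤ.+-monoˡ-≤ (- + 1) (descent-bound a j) ⟩
    h (a + + j) - + 1   ≤⟨ slow (a + + j) ⟩
    h (suc (a + + j))   ≡⟨ cong h (regroup′ a (+ j)) ⟩
    h (a + (+ 1 + + j)) ∎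
    where open ℤ.≤-Reasoning
          regroup : ∀ a j → a - (+ 1 + j) ≡ a - j - + 1
          regroup = solve-∀
          regroup′ : ∀ a j → + 1 + (a + j) ≡ a + (+ 1 + j)
          regroup′ = solve-∀

  first-return : ∀ p → h (pred p) < h p → ∀ j →
                 (∀ i → i ℕ.≤ j → h (pred p) < h (p + + i)) ⊎ Σ ℤ (Matched h p)
  first-return p opens zero =
    inj₁ λ { zero ℕ.z≤n → subst (λ y → h (pred p) < h y) (sym (ℤ.+-identityʳ p)) opens }
  first-return p opens (ℕ.suc j) with first-return p opens j
  ... | inj₂ closed = inj₂ closed
  ... | inj₁ above with h (pred p) <? h (p + + ℕ.suc j)
  ...   | yes still-above = inj₁ extend
    where
    extend : ∀ i → i ℕ.≤ ℕ.suc j → h (pred p) < h (p + + i)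
    extend i i≤1+j with ℕ.m≤n⇒m<n∨m≡n i≤1+j
    ... | inj₁ (ℕ.s≤s i≤j) = above i i≤j
    ... | inj₂ refl        = still-above
  ...   | no ¬above = inj₂ (p + + ℕ.suc j , p<q , returns , between)
    where
    q = p + + ℕ.suc j
    regroup : ∀ p j → p + (+ 1 + j) ≡ + 1 + (p + j)
    regroup = solve-∀
    p<q : p < q
    p<q = ℤ.≤-<-trans (ℤ.≤-reflexive (sym (ℤ.+-identityʳ p)))
            (ℤ.+-monoʳ-< p (+<+ (ℕ.s≤s ℕ.z≤n)))
    back-up : ∀ a → a ≡ + 1 + a - + 1
    back-up = solve-∀
    returns : h q ≡ h (pred p)
    returns = ℤ.≤-antisym (ℤ.≮⇒≥ ¬above) (begin
      h (pred p)                  ≡⟨ back-up (h (pred p)) ⟩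
      + 1 + h (pred p) - + 1      ≤⟨ ℤ.+-monoˡ-≤ (- + 1) (ℤ.i<j⇒suc[i]≤j (above j ℕ.≤-refl)) ⟩
      h (p + + j) - + 1           ≤⟨ slow (p + + j) ⟩
      h (suc (p + + j))           ≡⟨ cong h (sym (regroup p (+ j))) ⟩
      h q                         ∎)
      where open ℤ.≤-Reasoning
    between : ∀ m → p ≤ m → m < q → h (pred p) < h m
    between m p≤m m<q = subst (λ y → h (pred p) < h y) (sym (≤⇒+distance p≤m)) (above _ i≤j)
      where
      i≤j : ∣ m - p ∣ ℕ.≤ j
      i≤j = ℕ.s≤s⁻¹ (ℤ.drop‿+<+ (begin-strict
        + ∣ m - p ∣   ≡⟨ ℤ.0≤i⇒+∣i∣≡i (ℤ.i≤j⇒0≤j-i p≤m) ⟩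
        m - p         <⟨ ℤ.+-monoˡ-< (- p) m<q ⟩
        q - p         ≡⟨ cancel p (+ ℕ.suc j) ⟩
        + ℕ.suc j     ∎))
        where open ℤ.≤-Reasoning
              cancel : ∀ p j → p + j - p ≡ j
              cancel = solve-∀

  unmatched-opener : ∀ p → h (pred p) < h p → ¬ Σ ℤ (Matched h p) → NeverClosed h
  unmatched-opener p opens unmatched = p , λ x p≤x → stays-above x p≤x (first-return p opens ∣ x - p ∣)
    where
    stays-above : ∀ x → p ≤ x →
                  (∀ i → i ℕ.≤ ∣ x - p ∣ → h (pred p) < h (p + + i)) ⊎ Σ ℤ (Matched h p) →
                  h (pred p) < h x
    stays-above x p≤x (inj₁ above)  =
      subst (λ y → h (pred p) < h y) (sym (≤⇒+distance p≤x)) (above _ ℕ.≤-refl)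
    stays-above x p≤x (inj₂ closed) = ⊥-elim (unmatched closed)

-- An unmatched bracket is either an opener that is never closed or a
-- closer that is never opened; the second case is the first one for the
-- reflected word.
unmatched-bracket : ∀ χ n → ¬ Σ ℤ (Partner (height χ) n) →
                    NeverClosed (height χ) ⊎ NeverOpened (height χ)
unmatched-bracket χ n unmatched with χ n in χn≡b
... | true  = inj₁ (unmatched-opener (height-slow χ) n (opener-raises χ n χn≡b)
                     λ { (q , n→q) → unmatched (q , inj₁ n→q) })
... | false = inj₂ (reflect-never-closed (reflected-inverse φ≈χ)
                     (unmatched-opener (height-slow φ) n' (opener-raises φ n' φn'≡true) unmatched′))
  where
  φ : 2^ℤ
  φ m = not (χ (- (m - 0ℤ)))
  φ≈χ : Reflected (height φ) (height χ) 0ℤ _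
  φ≈χ = proj₂ (height-reflect χ 0ℤ)
  n' = - n + 0ℤ
  involutive : ∀ n → - (- n + 0ℤ - 0ℤ) ≡ n
  involutive = solve-∀
  involutive′ : ∀ n → - (- n + 0ℤ) + 0ℤ ≡ n
  involutive′ = solve-∀
  φn'≡true : φ n' ≡ true
  φn'≡true = cong not (trans (cong χ (involutive n)) χn≡b)
  unmatched′ : ¬ Σ ℤ (Matched (height φ) n')
  unmatched′ (q , n'→q) = unmatched (- q + 0ℤ , subst (λ y → Partner (height χ) y (- q + 0ℤ))
    (involutive′ n) (reflect-partner (reflected-inverse φ≈χ) (inj₁ n'→q)))

partner-bijection : ∀ χ (full : Full (height χ)) → IsBijection2ℤ→2ℤ+1 (λ n → proj₁ (full n))
partner-bijection χ full =
  (λ n → partner-of-even χ (proj₂ (full n))) ,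
  (λ m n _ _ same-partner → partner-functional (partner-sym (proj₂ (full m)))
     (subst (λ q → Partner (height χ) q n) (sym same-partner) (partner-sym (proj₂ (full n))))) ,
  λ o odd-o → proj₁ (full o) , partner-of-odd χ (proj₂ (full o)) odd-o ,
              partner-functional (proj₂ (full (proj₁ (full o)))) (partner-sym (proj₂ (full o)))

Orientation : (ℤ → ℤ) → Set
Orientation h = EvenMin h ⊎ (¬ HasMin h × NeverClosed h)

translate-orientation : ∀ {h' h D c} → Translated h' h D c → Even D → Orientation h → Orientation h'
translate-orientation h'≈h even-D (inj₁ (m , even-m , min)) =
  inj₁ (_ , even-+ even-m even-D , translate-min h'≈h min)
translate-orientation h'≈h even-D (inj₂ (no-min , never-closed)) =
  inj₂ ((λ { (m , min) → no-min (_ , translate-min (translated-inverse h'≈h) min) }) ,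
        translate-never-closed h'≈h never-closed)

mirror-even : ∀ {m D} → Even m → Even D → Odd (pred (- m + D))
mirror-even even-m even-D = even-pred (even-+ (even-neg even-m) even-D)

mirror-odd : ∀ {m D} → Odd m → Even D → Even (pred (- m + D))
mirror-odd {D = D} (a , refl) (k , refl) = odd-pred (k - a - + 1 , regroup a k)
  where regroup : ∀ a k → - (+ 2 * a + + 1) + + 2 * k ≡ + 2 * (k - a - + 1) + + 1
        regroup = solve-∀

shift : Bool → ℤ → ℤ
shift true  n = n + + 1
shift false n = n - + 1

shift-bijection : ∀ b → IsBijection2ℤ→2ℤ+1 (shift b)
shift-bijection true  = (λ n → odd-suc) , (λ m n _ _ → +-cancelʳ (+ 1)) ,
                        λ { o (k , refl) → + 2 * k , (k , refl) , refl }
shift-bijection false = (λ n even-n → subst Odd (ℤ.+-comm (-[1+ 0 ]) n) (even-pred even-n)) ,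
                        (λ m n _ _ → +-cancelʳ (- + 1)) ,
                        λ { o (k , refl) → + 2 * (k + + 1) , (k + + 1 , refl) , back k }
  where back : ∀ k → + 2 * (k + + 1) - + 1 ≡ + 2 * k + + 1
        back = solve-∀

shift-translate : ∀ b D n → shift b (n + D) ≡ shift b n + D
shift-translate true  D n = commute n D
  where commute : ∀ n D → n + D + + 1 ≡ n + + 1 + D
        commute = solve-∀
shift-translate false D n = commute n D
  where commute : ∀ n D → n + D - + 1 ≡ n - + 1 + D
        commute = solve-∀

shift-reflect : ∀ b D n → shift (not b) (- n + D) ≡ - shift b n + D
shift-reflect true  D n = commute n D
  where commute : ∀ n D → - n + D - + 1 ≡ - (n + + 1) + D
        commute = solve-∀
shift-reflect false D n = commute n D
  where commute : ∀ n D → - n + D + + 1 ≡ - (n - + 1) + D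
        commute = solve-∀

candidate : ∀ {h} → Dec (Full h) → Bool → ℤ → ℤ
candidate (yes full) _ n = proj₁ (full n)
candidate (no _)     b n = shift b n

candidate-bijection : ∀ χ (d : Dec (Full (height χ))) b → IsBijection2ℤ→2ℤ+1 (candidate d b)
candidate-bijection χ (yes full) _ = partner-bijection χ full
candidate-bijection χ (no _)     b = shift-bijection b

candidate-translate : ∀ {h' h D c} → Translated h' h D c →
  (d' : Dec (Full h')) (d : Dec (Full h)) → ∀ {b' b} → b' ≡ b →
  ∀ n → candidate d' b' (n + D) ≡ candidate d b n + D
candidate-translate h'≈h (yes full') (yes full) _ n =
  partner-functional (proj₂ (full' (n + _))) (translate-partner h'≈h (proj₂ (full n)))
candidate-translate h'≈h (yes full') (no ¬full) _ n =
  ⊥-elim (¬full (translate-full (translated-inverse h'≈h) full'))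
candidate-translate h'≈h (no ¬full') (yes full) _ n = ⊥-elim (¬full' (translate-full h'≈h full))
candidate-translate h'≈h (no _) (no _) {b} refl n = shift-translate b _ n

candidate-reflect : ∀ {h' h D c} → Reflected h' h D c →
  (d' : Dec (Full h')) (d : Dec (Full h)) → ∀ {b' b} → (¬ Full h → b' ≡ not b) →
  ∀ n → candidate d' b' (- n + D) ≡ - candidate d b n + D
candidate-reflect h'≈h (yes full') (yes full) _ n =
  partner-functional (proj₂ (full' (- n + _))) (reflect-partner h'≈h (proj₂ (full n)))
candidate-reflect h'≈h (yes full') (no ¬full) _ n =
  ⊥-elim (¬full (reflect-full (reflected-inverse h'≈h) full'))
candidate-reflect h'≈h (no ¬full') (yes full) _ n = ⊥-elim (¬full' (reflect-full h'≈h full))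
candidate-reflect h'≈h (no _) (no ¬full) {b = b} opposite n
  rewrite opposite ¬full = shift-reflect b _ n

-- Excluded middle is used to decide fullness and orientation, to find an
-- unmatched bracket in a non-full word, and to locate minima.
module WithExcludedMiddle (em : ExcludedMiddle 0ℓ) where

  decide : Set → Bool
  decide P = does (em {P})

  decide-cong : ∀ {P Q} → (P → Q) → (Q → P) → decide P ≡ decide Q
  decide-cong {P} {Q} P→Q Q→P with em {Q}
  ... | yes q = dec-true (em {P}) (Q→P q)
  ... | no ¬q = dec-false (em {P}) (λ p → ¬q (P→Q p))

  decide-neg : ∀ {P Q} → (P → ¬ Q) → (¬ Q → P) → decide P ≡ not (decide Q)
  decide-neg {P} {Q} P→¬Q ¬Q→P with em {Q}
  ... | yes q = dec-false (em {P}) (λ p → P→¬Q p q)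
  ... | no ¬q = dec-true (em {P}) (¬Q→P ¬q)

  not-full⇒unmatched : ∀ {h} → ¬ Full h → Σ ℤ λ n → ¬ Σ ℤ (Partner h n)
  not-full⇒unmatched {h} ¬full with em {Σ ℤ λ n → ¬ Σ ℤ (Partner h n)}
  ... | yes unmatched = unmatched
  ... | no  ¬unmatched = ⊥-elim (¬full λ n → partner-of n (em {Σ ℤ (Partner h n)}))
    where partner-of : ∀ n → Dec (Σ ℤ (Partner h n)) → Σ ℤ (Partner h n)
          partner-of n (yes partner) = partner
          partner-of n (no none)     = ⊥-elim (¬unmatched (n , none))

  -- A function bounded below attains its minimum: keep descending to
  -- smaller values; the bound limits the number of descents.
  bounded-below⇒min : ∀ (f : ℤ → ℤ) B → (∀ x → B ≤ f x) → HasMin f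
  bounded-below⇒min f B bound = descend ∣ f 0ℤ - B ∣ 0ℤ (ℤ.≤-reflexive (≤⇒+distance (bound 0ℤ)))
    where
    drop : ∀ B N → -[1+ 0 ] + (B + (+ 1 + N)) ≡ B + N
    drop = solve-∀
    descend : ∀ N m → f m ≤ B + + N → HasMin f
    descend zero m fm≤B = m , λ x → ℤ.≤-trans (subst (f m ≤_) (ℤ.+-identityʳ B) fm≤B) (bound x)
    descend (ℕ.suc N) m fm≤B+1+N with em {Σ ℤ λ x → f x < f m}
    ... | yes (x , fx<fm) =
      descend N x (subst (f x ≤_) (drop B (+ N)) (ℤ.i<j⇒i≤pred[j] (ℤ.<-≤-trans fx<fm fm≤B+1+N)))
    ... | no smallest = m , λ x → ℤ.≮⇒≥ (λ fx<fm → smallest (x , fx<fm))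

  -- A never-closed opener at o and a never-opened closer at c bound the
  -- height below: right of o by h (pred o), left of c by h c, and on [c, o]
  -- by slow descent from c.
  closed-and-opened⇒min : ∀ {h} → SlowDescent h → NeverClosed h → NeverOpened h → HasMin h
  closed-and-opened⇒min {h} slow (o , above-o) (c , above-c) = bounded-below⇒min h B bound
    where
    B = h (pred o) ⊓ (h c ⊓ (h c - (o - c)))
    bound : ∀ x → B ≤ h x
    bound x with o ℤ.≤? x
    ... | yes o≤x = ℤ.≤-trans (ℤ.i⊓j≤i _ _) (ℤ.<⇒≤ (above-o x o≤x))
    ... | no o≰x with x <? c
    ...   | yes x<c = ℤ.≤-trans (ℤ.i⊓j≤j _ _) (ℤ.≤-trans (ℤ.i⊓j≤i _ _) (ℤ.<⇒≤ (above-c x x<c)))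
    ...   | no x≮c = ℤ.≤-trans (ℤ.i⊓j≤j _ _) (ℤ.≤-trans (ℤ.i⊓j≤j _ _) (begin
      h c - (o - c)          ≤⟨ ℤ.+-monoʳ-≤ (h c) (ℤ.neg-mono-≤ (ℤ.+-monoˡ-≤ (- c) x≤o)) ⟩
      h c - (x - c)          ≡⟨ cong (λ y → h c - y) (sym (ℤ.0≤i⇒+∣i∣≡i (ℤ.i≤j⇒0≤j-i c≤x))) ⟩
      h c - + ∣ x - c ∣      ≤⟨ descent-bound {h} slow c ∣ x - c ∣ ⟩
      h (c + + ∣ x - c ∣)    ≡⟨ cong h (sym (≤⇒+distance c≤x)) ⟩
      h x                    ∎))
      where open ℤ.≤-Reasoning
            c≤x : c ≤ x
            c≤x = ℤ.≮⇒≥ x≮c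
            x≤o : x ≤ o
            x≤o = ℤ.<⇒≤ (ℤ.≰⇒> o≰x)

  -- Reflection about an even centre reverses the orientation of a word that
  -- is not full: the two orientations are exclusive ...
  reflect-exclusive : ∀ {φ χ D c} → Reflected (height φ) (height χ) D c → Even D →
                      Orientation (height φ) → ¬ Orientation (height χ)
  reflect-exclusive {χ = χ} {D} φ≈χ even-D (inj₁ (m' , even-m' , min')) (inj₁ (m , even-m , min)) =
    even-odd-disjoint (same-parity-even (minima-same-parity χ {pred (- m' + D)} {m} min″ min) even-m)
                      (mirror-even even-m' even-D)
    where min″ : IsMin (height χ) (pred (- m' + D))
          min″ = reflect-min (reflected-inverse φ≈χ) {m'} min'
  reflect-exclusive {D = D} φ≈χ _ (inj₁ (m' , _ , min')) (inj₂ (no-min , _)) =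
    no-min (pred (- m' + D) , reflect-min (reflected-inverse φ≈χ) {m'} min')
  reflect-exclusive {D = D} φ≈χ _ (inj₂ (no-min' , _)) (inj₁ (m , _ , min)) =
    no-min' (pred (- m + D) , reflect-min φ≈χ {m} min)
  reflect-exclusive {χ = χ} φ≈χ _ (inj₂ (_ , never-closed')) (inj₂ (no-min , never-closed)) =
    no-min (closed-and-opened⇒min (height-slow χ) never-closed
              (reflect-never-closed (reflected-inverse φ≈χ) never-closed'))

  -- ... and, because some bracket of χ is unmatched, exhaustive.
  reflect-exhaustive : ∀ {φ χ D c} → Reflected (height φ) (height χ) D c → Even D →
                       ¬ Full (height χ) → ¬ Orientation (height χ) → Orientation (height φ)
  reflect-exhaustive {χ = χ} {D} φ≈χ even-D ¬full ¬oriented with em {HasMin (height χ)}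
  ... | yes (m , min) with even-or-odd m
  ...   | inj₁ even-m = ⊥-elim (¬oriented (inj₁ (m , even-m , min)))
  ...   | inj₂ odd-m  = inj₁ (pred (- m + D) , mirror-odd odd-m even-D , reflect-min φ≈χ {m} min)
  reflect-exhaustive {χ = χ} {D} φ≈χ even-D ¬full ¬oriented | no no-min
    with unmatched-bracket χ _ (proj₂ (not-full⇒unmatched ¬full))
  ... | inj₁ never-closed = ⊥-elim (¬oriented (inj₂ (no-min , never-closed)))
  ... | inj₂ never-opened =
    inj₂ ((λ { (m' , min') →
               no-min (pred (- m' + D) , reflect-min (reflected-inverse φ≈χ) {m'} min') }) ,
          reflect-never-opened φ≈χ never-opened)

  ψ : Family
  ψ χ = candidate (em {Full (height χ)}) (decide (Orientation (height χ)))

  ψ-bijections : IsFamilyOfBijections ψ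
  ψ-bijections χ = candidate-bijection χ (em {Full (height χ)}) _

  ψ-equivariant : Equivariant ψ
  ψ-equivariant (t^ k r^ false) χ n _ =
    candidate-translate φ≈χ (em {Full (height φ)}) (em {Full (height χ)})
      (decide-cong (translate-orientation (translated-inverse φ≈χ) (even-neg even-D))
                   (translate-orientation φ≈χ even-D)) n
    where φ : 2^ℤ
          φ = (t^ k r^ false) ·χ χ
          even-D : Even (+ 2 * k)
          even-D = k , refl
          φ≈χ : Translated (height φ) (height χ) (+ 2 * k) _
          φ≈χ = proj₂ (height-translate χ (+ 2 * k))
  ψ-equivariant (t^ k r^ true) χ n _ =
    candidate-reflect φ≈χ (em {Full (height φ)}) (em {Full (height χ)})
      (λ ¬full → decide-neg (reflect-exclusive φ≈χ even-D) (reflect-exhaustive φ≈χ even-D ¬full)) n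
    where φ : 2^ℤ
          φ = (t^ k r^ true) ·χ χ
          even-D : Even (+ 2 * k)
          even-D = k , refl
          φ≈χ : Reflected (height φ) (height χ) (+ 2 * k) _
          φ≈χ = proj₂ (height-reflect χ (+ 2 * k))

-- Part (1): for the reflection r = t⁰ r¹ and the constant word, equivariance
-- of n ↦ n ± 1 at n = 0 would say ψ(0) = - ψ(0), i.e. ± 1 = ∓ 1.
shift-up-not-equivariant : ¬ Equivariant (λ χ n → n + + 1)
shift-up-not-equivariant equivariant
  with equivariant (t^ 0ℤ r^ true) (λ _ → true) 0ℤ (0ℤ , refl)
... | ()

shift-down-not-equivariant : ¬ Equivariant (λ χ n → n - + 1)
shift-down-not-equivariant equivariant
  with equivariant (t^ 0ℤ r^ true) (λ _ → true) 0ℤ (0ℤ , refl)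
... | ()

proposition3p3 :
    (¬ Equivariant (λ χ n → n + + 1)) ×
    (¬ Equivariant (λ χ n → n - + 1)) ×
    (ExcludedMiddle 0ℓ →
      Σ Family λ ψ → IsFamilyOfBijections ψ × Equivariant ψ)
proposition3p3 =
  shift-up-not-equivariant ,
  shift-down-not-equivariant ,
  λ em → let open WithExcludedMiddle em in ψ , ψ-bijections , ψ-equivariant
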